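{- For every integer $n\geq 4$, \[ \gamma_{\times 2}^{r}(C_n\overline{C_n})=\begin{cases} 2n & \text{if } n=4,5,\\ n+2 & \text{otherwise.}\end{cases} \]
   Context: All graphs are finite, simple and undirected; $C_n$ is the cycle on $n$ vertices and $\overline{G}$ is the complement of $G$. The complementary prism $G\overline{G}$ of a graph $G$ is formed from the disjoint union of $G$ and $\overline{G}$ by adding the edges of a perfect matching joining each vertex of $G$ to its corresponding copy in $\overline{G}$. For a graph $H=(V,E)$ with $\delta(H)\geq k-1$ and $x\in V$ with closed neighborhood $N[x]$: $S\subseteq V$ is a $k$-tuple restrained dominating set if $|N[x]\cap S|\geq k$ for all $x\in V$ and every vertex of $V-S$ has at least $k$ neighbors in $V-S$; $\gamma_{\times k}^{r}(H)$ is the minimum cardinality of such a set. -}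

module Defs where

open import Data.Nat using (ℕ; zero; suc; _+_; _≤_; _≡ᵇ_; _%_)
open import Data.Bool using (Bool; true; false; not; _∧_; _∨_)
open import Data.Fin using (Fin; toℕ; splitAt)
open import Data.Fin.Subset using (Subset; _∉_; ∣_∣; ∁) renaming (_∩_ to _∩ˢ_)
open import Data.Vec using (tabulate)
open import Data.Sum using (_⊎_; inj₁; inj₂)
open import Data.Product using (Σ; _×_)
open import Relation.Binary.PropositionalEquality using (_≡_)

-- A graph on vertex set Fin m, given by a Bool-valued adjacency relation.
-- (All graphs built below are simple: symmetric and irreflexive.)
Graph : ℕ → Set
Graph m = Fin m → Fin m → Bool

_==_ : ∀ {m} → Fin m → Fin m → Bool
i == j = toℕ i ≡ᵇ toℕ j

N : ∀ {m} → Graph m → Fin m → Subset m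
N G x = tabulate (λ y → G x y)

N[_] : ∀ {m} → Graph m → Fin m → Subset m
N[ G ] x = tabulate (λ y → G x y ∨ (x == y))

MinDegAtLeast : ∀ {m} → Graph m → ℕ → Set
MinDegAtLeast G d = ∀ x → d ≤ ∣ N G x ∣

IsKTupleRestrainedDom : ∀ {m} → Graph m → ℕ → Subset m → Set
IsKTupleRestrainedDom G k S =
  (∀ x → k ≤ ∣ N[ G ] x ∩ˢ S ∣) ×
  (∀ x → x ∉ S → k ≤ ∣ N G x ∩ˢ ∁ S ∣)

KTupleRestrainedDomNumberIs : ∀ {m} → Graph m → ℕ → ℕ → Set
KTupleRestrainedDomNumberIs {m} G k g =
  Σ (Subset m) (λ S → IsKTupleRestrainedDom G k S × ∣ S ∣ ≡ g)
  × (∀ S → IsKTupleRestrainedDom G k S → g ≤ ∣ S ∣)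

-- the cycle C_n on vertices 0,…,n−1: i ~ j iff j ≡ i+1 or i ≡ j+1 (mod n)
-- (a simple graph for n ≥ 3)
Cycle : (n : ℕ) → Graph n
Cycle zero    i j = false
Cycle (suc n) i j =
  ((suc (toℕ i) % suc n) ≡ᵇ toℕ j) ∨ ((suc (toℕ j) % suc n) ≡ᵇ toℕ i)

complement : ∀ {m} → Graph m → Graph m
complement G i j = not (G i j) ∧ not (i == j)

-- complementary prism G Ḡ on 2m vertices: the first m are G, the last m
-- are Ḡ, and vertex i of G is matched with its copy i of Ḡ
compPrism : ∀ {m} → Graph m → Graph (m + m)
compPrism {m} G u v with splitAt m u | splitAt m v
... | inj₁ i | inj₁ j = G i j
... | inj₂ i | inj₂ j = complement G i j
... | inj₁ i | inj₂ j = i == j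
... | inj₂ i | inj₁ j = i == j

-- In the prism C_n C̄_n every vertex of C_n has degree 3, whereas a vertex outside a
-- 2-tuple restrained dominating set S has two neighbours in S and two outside it; hence
-- V(C_n) ⊆ S.  For n = 4, 5 the copies have degree n − 2 ≤ 3 too, so S is everything.
-- For n ≥ 6, S also contains two copies: if i ~ j in C_n, the copy i′ has a single
-- neighbour outside the copy C̄_n, so S meets the closed neighbourhood of i′ in C̄_n,
-- which misses j′; used twice this yields two distinct copies in S.  Conversely
-- V(C_n) ∪ {0′, 3′} is a 2-tuple restrained dominating set when n ≥ 6.
module Submission where

open import Defs
open import Data.Nat using (ℕ; zero; suc; _+_; _*_; _≤_; _<_; z≤n; s≤s; _≡ᵇ_; _≤ᵇ_; _%_)
open import Data.Nat.Properties
  using (+-comm; +-suc; +-mono-≤; +-monoˡ-≤; +-monoʳ-≤; +-cancelˡ-≤; ≤-trans; ≤-reflexive;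
         ≤-antisym; <-trans; <-irrefl; <⇒≱; ≮⇒≥; n≤1+n; m<n⇒m<1+n; m+n≤o⇒n≤o; 1+n≢n;
         ≤ᵇ⇒≤; ≡ᵇ⇒≡; _<?_; _≤?_; module ≤-Reasoning)
  renaming (suc-injective to ℕ-suc-injective)
open import Data.Nat.DivMod using (m%n<n; m<n⇒m%n≡m; n%n≡0)
open import Data.Bool using (Bool; true; false; not; _∧_; _∨_; T; if_then_else_)
open import Data.Bool.Properties using (¬-not; ∨-comm; ∨-zeroʳ; ∨-identityʳ; ∧-zeroʳ)
open import Data.Fin using (Fin; zero; suc; toℕ; fromℕ<; splitAt; _↑ˡ_; _↑ʳ_)
open import Data.Fin.Patterns using (0F; 1F; 2F; 3F; 4F; 5F)
open import Data.Fin.Properties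
  using (toℕ-injective; toℕ-fromℕ<; toℕ<n; 0≢1+n; suc-injective; splitAt-↑ˡ; splitAt-↑ʳ;
         splitAt⁻¹-↑ˡ; splitAt⁻¹-↑ʳ; ↑ˡ-injective; ↑ʳ-injective; all?)
open import Data.Fin.Subset using (Subset; _∈_; _∉_; ∣_∣; ∁; ⊤) renaming (_∩_ to _∩ˢ_)
open import Data.Fin.Subset.Properties
  using (∈⊤; ⊆⊤; ⊆-antisym; ∣⊤∣≡n; _∈?_; ∣p∣≤∣x∷p∣; ∩-identityʳ)
open import Data.Vec using ([]; _∷_; tabulate; lookup)
open import Data.Vec.Properties
  using (lookup∘tabulate; tabulate∘lookup; tabulate-cong; lookup-map; []=⇒lookup; lookup⇒[]=)
open import Data.Sum using (_⊎_; inj₁; inj₂; [_,_]′)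
open import Data.Product using (∃; ∃₂; _×_; _,_; proj₁; proj₂)
open import Function using (_∘_; const)
open import Relation.Nullary using (yes; no; contradiction)
open import Relation.Nullary.Decidable using (from-yes)
open import Relation.Binary.PropositionalEquality

-- Counting as ∣ tabulate f ∣ makes ∣ N G x ∣ literally count (G x).
count : ∀ {m} → (Fin m → Bool) → ℕ
count f = ∣ tabulate f ∣

count-cong : ∀ {m} {f g : Fin m → Bool} → (∀ y → f y ≡ g y) → count f ≡ count g
count-cong f≗g = cong ∣_∣ (tabulate-cong f≗g)

∣p∣≡count-lookup : ∀ {m} (p : Subset m) → ∣ p ∣ ≡ count (lookup p)
∣p∣≡count-lookup p = cong ∣_∣ (sym (tabulate∘lookup p))

tabulate-∩ : ∀ {m} (f : Fin m → Bool) (p : Subset m) →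
             tabulate f ∩ˢ p ≡ tabulate (λ y → f y ∧ lookup p y)
tabulate-∩ f []      = refl
tabulate-∩ f (b ∷ p) = cong (f zero ∧ b ∷_) (tabulate-∩ (f ∘ suc) p)

∣tabulate∩∣ : ∀ {m} (f : Fin m → Bool) (p : Subset m) →
              ∣ tabulate f ∩ˢ p ∣ ≡ count (λ y → f y ∧ lookup p y)
∣tabulate∩∣ f p = cong ∣_∣ (tabulate-∩ f p)

∣tabulate∩∁∣ : ∀ {m} (f : Fin m → Bool) (p : Subset m) →
               ∣ tabulate f ∩ˢ ∁ p ∣ ≡ count (λ y → f y ∧ not (lookup p y))
∣tabulate∩∁∣ f p = trans (∣tabulate∩∣ f (∁ p)) (count-cong λ y → cong (f y ∧_) (lookup-map y not p))

count-↑ : ∀ m {k} (f : Fin (m + k) → Bool) →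
          count f ≡ count (λ i → f (i ↑ˡ k)) + count (λ i → f (m ↑ʳ i))
count-↑ zero    f = refl
count-↑ (suc m) f with f zero
... | true  = cong suc (count-↑ m (f ∘ suc))
... | false = count-↑ m (f ∘ suc)

count-none : ∀ {m} (f : Fin m → Bool) → (∀ y → f y ≡ false) → count f ≡ 0
count-none {zero}  f none = refl
count-none {suc m} f none rewrite none zero = count-none (f ∘ suc) (none ∘ suc)

count-all : ∀ {m} (f : Fin m → Bool) → (∀ y → f y ≡ true) → count f ≡ m
count-all {zero}  f all = refl
count-all {suc m} f all rewrite all zero = cong suc (count-all (f ∘ suc) (all ∘ suc))

count≥1 : ∀ {m} (f : Fin m → Bool) {a} → f a ≡ true → 1 ≤ count f
count≥1 f {zero}  fa rewrite fa = s≤s z≤n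
count≥1 f {suc a} fa = ≤-trans (count≥1 (f ∘ suc) fa) (∣p∣≤∣x∷p∣ (f zero) (tabulate (f ∘ suc)))

count≥2 : ∀ {m} (f : Fin m → Bool) {a b} → f a ≡ true → f b ≡ true → a ≢ b → 2 ≤ count f
count≥2 f {zero}  {zero}  _  _  a≢b = contradiction refl a≢b
count≥2 f {zero}  {suc b} fa fb _   rewrite fa = s≤s (count≥1 (f ∘ suc) fb)
count≥2 f {suc a} {zero}  fa fb _   rewrite fb = s≤s (count≥1 (f ∘ suc) fa)
count≥2 f {suc a} {suc b} fa fb a≢b =
  ≤-trans (count≥2 (f ∘ suc) fa fb (a≢b ∘ cong suc)) (∣p∣≤∣x∷p∣ (f zero) (tabulate (f ∘ suc)))

count≥1⇒∃ : ∀ {m} (f : Fin m → Bool) → 1 ≤ count f → ∃ λ y → f y ≡ true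
count≥1⇒∃ {suc m} f h with f zero in f0
... | true  = zero , f0
... | false with count≥1⇒∃ (f ∘ suc) h
...   | y , fy = suc y , fy

count≤1 : ∀ {m} (f : Fin m → Bool) → (∀ y z → f y ≡ true → f z ≡ true → y ≡ z) → count f ≤ 1
count≤1 {zero}  f _ = z≤n
count≤1 {suc m} f unique with f zero in f0
... | true  = ≤-reflexive (cong suc (count-none (f ∘ suc) λ y →
                ¬-not λ fy → 0≢1+n (unique zero (suc y) f0 fy)))
... | false = count≤1 (f ∘ suc) λ y z fy fz → suc-injective (unique (suc y) (suc z) fy fz)

count-∨ : ∀ {m} (f g : Fin m → Bool) → count (λ y → f y ∨ g y) ≤ count f + count g
count-∨ {zero}  f g = z≤n
count-∨ {suc m} f g with f zero | g zero
... | true  | true  = s≤s (≤-trans (count-∨ (f ∘ suc) (g ∘ suc)) (+-monoʳ-≤ (count (f ∘ suc)) (n≤1+n _)))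
... | true  | false = s≤s (count-∨ (f ∘ suc) (g ∘ suc))
... | false | true  = ≤-trans (s≤s (count-∨ (f ∘ suc) (g ∘ suc))) (≤-reflexive (sym (+-suc _ _)))
... | false | false = count-∨ (f ∘ suc) (g ∘ suc)

count-partition : ∀ {m} (f s : Fin m → Bool) →
                  count f ≡ count (λ y → f y ∧ s y) + count (λ y → f y ∧ not (s y))
count-partition {zero}  f s = refl
count-partition {suc m} f s with f zero | s zero
... | true  | true  = cong suc (count-partition (f ∘ suc) (s ∘ suc))
... | true  | false = trans (cong suc (count-partition (f ∘ suc) (s ∘ suc))) (sym (+-suc _ _))
... | false | _     = count-partition (f ∘ suc) (s ∘ suc)

==-refl : ∀ {m} (i : Fin m) → (i == i) ≡ true
==-refl zero    = refl
==-refl (suc i) = ==-refl i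

==⇒≡ : ∀ {m} (i j : Fin m) → (i == j) ≡ true → i ≡ j
==⇒≡ zero    zero    _ = refl
==⇒≡ (suc i) (suc j) e = cong suc (==⇒≡ i j e)

≢⇒==-false : ∀ {m} {i j : Fin m} → i ≢ j → (i == j) ≡ false
≢⇒==-false {i = i} {j} i≢j = ¬-not (i≢j ∘ ==⇒≡ i j)

count-== : ∀ {m} (i : Fin m) → count (i ==_) ≡ 1
count-== {suc m} zero = cong suc (count-none {m} (λ y → zero == suc y) λ _ → refl)
count-== (suc i)       = count-== i

-- k-tuple restrained domination

closedAdj : ∀ {m} → Graph m → Graph m
closedAdj G x y = G x y ∨ (x == y)

closedAdj-refl : ∀ {m} (G : Graph m) x → closedAdj G x x ≡ true
closedAdj-refl G x = trans (cong (G x x ∨_) (==-refl x)) (∨-zeroʳ (G x x))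

adjacent⇒closedAdj : ∀ {m} (G : Graph m) {x y} → G x y ≡ true → closedAdj G x y ≡ true
adjacent⇒closedAdj G Gxy = cong (_∨ _) Gxy

∉⇒k+k≤degree : ∀ {m} (G : Graph m) {k S} → IsKTupleRestrainedDom G k S →
               ∀ {x} → x ∉ S → k + k ≤ ∣ N G x ∣
∉⇒k+k≤degree G {k} {S} (dom , restr) {x} x∉S =
  subst (k + k ≤_) (sym (count-partition (G x) (lookup S))) (+-mono-≤ nbrsIn nbrsOut)
  where
  Sx≡false : lookup S x ≡ false
  Sx≡false = ¬-not (x∉S ∘ lookup⇒[]= x S)
  closed≡open : ∀ y → closedAdj G x y ∧ lookup S y ≡ G x y ∧ lookup S y
  closed≡open y with x == y in x==y
  ... | true  rewrite subst (λ z → lookup S z ≡ false) (==⇒≡ x y x==y) Sx≡false =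
    trans (∧-zeroʳ _) (sym (∧-zeroʳ _))
  ... | false = cong (_∧ lookup S y) (∨-identityʳ (G x y))
  nbrsIn : k ≤ count (λ y → G x y ∧ lookup S y)
  nbrsIn = subst (k ≤_) (trans (∣tabulate∩∣ (closedAdj G x) S) (count-cong closed≡open)) (dom x)
  nbrsOut : k ≤ count (λ y → G x y ∧ not (lookup S y))
  nbrsOut = subst (k ≤_) (∣tabulate∩∁∣ (G x) S) (restr x x∉S)

degree<k+k⇒∈ : ∀ {m} (G : Graph m) {k S} → IsKTupleRestrainedDom G k S →
               ∀ {x} → ∣ N G x ∣ < k + k → x ∈ S
degree<k+k⇒∈ G {S = S} dom {x} deg with x ∈? S
... | yes x∈S = x∈S
... | no  x∉S = contradiction (∉⇒k+k≤degree G dom x∉S) (<⇒≱ deg)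

degree<k+k⇒≡⊤ : ∀ {m} (G : Graph m) {k S} → (∀ x → ∣ N G x ∣ < k + k) →
                IsKTupleRestrainedDom G k S → S ≡ ⊤
degree<k+k⇒≡⊤ G deg dom = ⊆-antisym ⊆⊤ (λ {x} _ → degree<k+k⇒∈ G dom (deg x))

-- Complementary prisms

compPrism-ˡˡ : ∀ {m} (G : Graph m) i j → compPrism G (i ↑ˡ m) (j ↑ˡ m) ≡ G i j
compPrism-ˡˡ {m} G i j rewrite splitAt-↑ˡ m i m | splitAt-↑ˡ m j m = refl

compPrism-ˡʳ : ∀ {m} (G : Graph m) i j → compPrism G (i ↑ˡ m) (m ↑ʳ j) ≡ (i == j)
compPrism-ˡʳ {m} G i j rewrite splitAt-↑ˡ m i m | splitAt-↑ʳ m m j = refl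

compPrism-ʳˡ : ∀ {m} (G : Graph m) i j → compPrism G (m ↑ʳ i) (j ↑ˡ m) ≡ (i == j)
compPrism-ʳˡ {m} G i j rewrite splitAt-↑ʳ m m i | splitAt-↑ˡ m j m = refl

compPrism-ʳʳ : ∀ {m} (G : Graph m) i j → compPrism G (m ↑ʳ i) (m ↑ʳ j) ≡ complement G i j
compPrism-ʳʳ {m} G i j rewrite splitAt-↑ʳ m m i | splitAt-↑ʳ m m j = refl

↑ˡ≢↑ʳ : ∀ {m} (i j : Fin m) → i ↑ˡ m ≢ m ↑ʳ j
↑ˡ≢↑ʳ {m} i j e with () ← trans (sym (splitAt-↑ˡ m i m)) (trans (cong (splitAt m) e) (splitAt-↑ʳ m m j))

==-ʳʳ : ∀ m {k} (i j : Fin k) → ((m ↑ʳ i) == (m ↑ʳ j)) ≡ (i == j)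
==-ʳʳ zero    i j = refl
==-ʳʳ (suc m) i j = ==-ʳʳ m i j

data Side {m} : Fin (m + m) → Set where
  base : ∀ i → Side (i ↑ˡ m)
  copy : ∀ i → Side (m ↑ʳ i)

side : ∀ {m} (x : Fin (m + m)) → Side x
side {m} x with splitAt m x in eq
... | inj₁ i = subst Side (splitAt⁻¹-↑ˡ eq) (base i)
... | inj₂ i = subst Side (splitAt⁻¹-↑ʳ eq) (copy i)

degree-base : ∀ {m} (G : Graph m) i → ∣ N (compPrism G) (i ↑ˡ m) ∣ ≡ suc ∣ N G i ∣
degree-base {m} G i = begin
  count (compPrism G (i ↑ˡ m))                ≡⟨ count-↑ m (compPrism G (i ↑ˡ m)) ⟩
  count (λ j → compPrism G (i ↑ˡ m) (j ↑ˡ m))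
    + count (λ j → compPrism G (i ↑ˡ m) (m ↑ʳ j)) ≡⟨ cong₂ _+_ (count-cong (compPrism-ˡˡ G i))
                                                             (count-cong (compPrism-ˡʳ G i)) ⟩
  count (G i) + count (i ==_)                 ≡⟨ cong (count (G i) +_) (count-== i) ⟩
  count (G i) + 1                             ≡⟨ +-comm (count (G i)) 1 ⟩
  suc (count (G i))                           ∎
  where open ≡-Reasoning

∧-true⇒ʳ : ∀ a {b} → a ∧ b ≡ true → b ≡ true
∧-true⇒ʳ true ab = ab

copy∈-avoiding : ∀ {m} (G : Graph m) {S} → IsKTupleRestrainedDom (compPrism G) 2 S →
                 ∀ {i j} → G i j ≡ true → i ≢ j → ∃ λ y → y ≢ j × m ↑ʳ y ∈ S
copy∈-avoiding {m} G {S} (dom , _) {i} {j} Gij i≢j =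
  y , y≢j , lookup⇒[]= (m ↑ʳ y) S (∧-true⇒ʳ (closedAdj (compPrism G) (m ↑ʳ i) (m ↑ʳ y)) Fy)
  where
  F : Fin (m + m) → Bool
  F y = closedAdj (compPrism G) (m ↑ʳ i) y ∧ lookup S y
  partner : ∀ k → F (k ↑ˡ m) ≡ true → i ≡ k
  partner k Fk rewrite compPrism-ʳˡ G i k | ≢⇒==-false {i = m ↑ʳ i} (↑ˡ≢↑ʳ k i ∘ sym)
    with i == k in i==k
  ...   | true = ==⇒≡ i k i==k
  bases≤1 : count (F ∘ (_↑ˡ m)) ≤ 1
  bases≤1 = count≤1 (F ∘ (_↑ˡ m)) λ y z Fy Fz → trans (sym (partner y Fy)) (partner z Fz)
  copies≥1 : 1 ≤ count (F ∘ (m ↑ʳ_))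
  copies≥1 = +-cancelˡ-≤ 1 1 _ (begin
    2                                          ≤⟨ subst (2 ≤_) (∣tabulate∩∣ _ S) (dom (m ↑ʳ i)) ⟩
    count F                                    ≡⟨ count-↑ m F ⟩
    count (F ∘ (_↑ˡ m)) + count (F ∘ (m ↑ʳ_))  ≤⟨ +-monoˡ-≤ _ bases≤1 ⟩
    1 + count (F ∘ (m ↑ʳ_))                    ∎)
    where open ≤-Reasoning
  y : Fin m
  y = proj₁ (count≥1⇒∃ (F ∘ (m ↑ʳ_)) copies≥1)
  Fy : F (m ↑ʳ y) ≡ true
  Fy = proj₂ (count≥1⇒∃ (F ∘ (m ↑ʳ_)) copies≥1)
  j-excluded : F (m ↑ʳ j) ≡ false
  j-excluded rewrite compPrism-ʳʳ G i j | ==-ʳʳ m i j | Gij | ≢⇒==-false i≢j = refl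
  y≢j : y ≢ j
  y≢j y≡j = contradiction (trans (sym j-excluded) (subst (λ z → F (m ↑ʳ z) ≡ true) y≡j Fy)) λ ()

copies≥2 : ∀ {m} (G : Graph (suc m)) → (∀ j → ∃ λ i → G i j ≡ true × i ≢ j) →
           ∀ {S} → IsKTupleRestrainedDom (compPrism G) 2 S → 2 ≤ count (λ k → lookup S (suc m ↑ʳ k))
copies≥2 G hasNbr dom with hasNbr zero
... | _ , Gi₀ , i₀≢ with copy∈-avoiding G dom Gi₀ i₀≢
... | y₁ , _ , y₁∈S with hasNbr y₁
... | _ , Gi₁ , i₁≢ with copy∈-avoiding G dom Gi₁ i₁≢
... | y₂ , y₂≢y₁ , y₂∈S = count≥2 _ ([]=⇒lookup y₁∈S) ([]=⇒lookup y₂∈S) (y₂≢y₁ ∘ sym)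

prism-lowerBound : ∀ {m} (G : Graph (suc m)) → (∀ i → ∣ N G i ∣ ≤ 2) →
                   (∀ j → ∃ λ i → G i j ≡ true × i ≢ j) →
                   ∀ S → IsKTupleRestrainedDom (compPrism G) 2 S → suc m + 2 ≤ ∣ S ∣
prism-lowerBound {m} G degree≤2 hasNbr S dom = begin
  n + 2                                  ≤⟨ +-mono-≤ (≤-reflexive (sym bases)) (copies≥2 G hasNbr dom) ⟩
  count (lookup S ∘ (_↑ˡ n))
    + count (lookup S ∘ (n ↑ʳ_))         ≡⟨ count-↑ n (lookup S) ⟨
  count (lookup S)                       ≡⟨ ∣p∣≡count-lookup S ⟨
  ∣ S ∣                                  ∎
  where
  open ≤-Reasoning
  n : ℕ
  n = suc m
  base-degree<4 : ∀ i → ∣ N (compPrism G) (i ↑ˡ n) ∣ < 2 + 2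
  base-degree<4 i = subst (_< 2 + 2) (sym (degree-base G i)) (s≤s (s≤s (degree≤2 i)))
  bases : count (lookup S ∘ (_↑ˡ n)) ≡ n
  bases = count-all (lookup S ∘ (_↑ˡ n)) λ i →
    []=⇒lookup (degree<k+k⇒∈ (compPrism G) dom (base-degree<4 i))

⊤-isRestrainedDom : ∀ {m} (G : Graph m) → IsKTupleRestrainedDom (compPrism G) 2 ⊤
⊤-isRestrainedDom {m} G = dom , λ x x∉⊤ → contradiction ∈⊤ x∉⊤
  where
  H : Graph (m + m)
  H = compPrism G
  self&partner : ∀ x → 2 ≤ count (closedAdj H x)
  self&partner x with side {m} x
  ... | base i = count≥2 (closedAdj H (i ↑ˡ m)) (closedAdj-refl H (i ↑ˡ m))
                   (adjacent⇒closedAdj H (trans (compPrism-ˡʳ G i i) (==-refl i))) (↑ˡ≢↑ʳ i i)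
  ... | copy i = count≥2 (closedAdj H (m ↑ʳ i)) (closedAdj-refl H (m ↑ʳ i))
                   (adjacent⇒closedAdj H (trans (compPrism-ʳˡ G i i) (==-refl i))) (↑ˡ≢↑ʳ i i ∘ sym)
  dom : ∀ x → 2 ≤ ∣ N[ H ] x ∩ˢ ⊤ ∣
  dom x = subst (2 ≤_) (sym (cong ∣_∣ (∩-identityʳ (N[ H ] x)))) (self&partner x)

prism-restrainedDomNumber-lowDegree : ∀ {m} (G : Graph m) → (∀ x → ∣ N (compPrism G) x ∣ ≤ 3) →
                                      KTupleRestrainedDomNumberIs (compPrism G) 2 (m + m)
prism-restrainedDomNumber-lowDegree {m} G degree≤3 =
  (⊤ , ⊤-isRestrainedDom G , ∣⊤∣≡n (m + m)) , λ S dom → ≤-reflexive (sym (∣S∣ S dom))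
  where
  ∣S∣ : ∀ S → IsKTupleRestrainedDom (compPrism G) 2 S → ∣ S ∣ ≡ m + m
  ∣S∣ S dom = trans (cong ∣_∣ (degree<k+k⇒≡⊤ (compPrism G) (s≤s ∘ degree≤3) dom))
                    (∣⊤∣≡n (m + m))

withCopies : ∀ {m} → (Fin m → Bool) → Subset (m + m)
withCopies {m} A = tabulate ([ const true , A ]′ ∘ splitAt m)

withCopies-base : ∀ {m} (A : Fin m → Bool) i → lookup (withCopies A) (i ↑ˡ m) ≡ true
withCopies-base {m} A i = trans (lookup∘tabulate _ (i ↑ˡ m)) (cong [ const true , A ]′ (splitAt-↑ˡ m i m))

withCopies-copy : ∀ {m} (A : Fin m → Bool) k → lookup (withCopies A) (m ↑ʳ k) ≡ A k
withCopies-copy {m} A k = trans (lookup∘tabulate _ (m ↑ʳ k)) (cong [ const true , A ]′ (splitAt-↑ʳ m m k))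

∣withCopies∣ : ∀ {m} (A : Fin m → Bool) → ∣ withCopies A ∣ ≡ m + count A
∣withCopies∣ {m} A = begin
  ∣ withCopies A ∣                                     ≡⟨ ∣p∣≡count-lookup (withCopies A) ⟩
  count (lookup (withCopies A))                        ≡⟨ count-↑ m (lookup (withCopies A)) ⟩
  count (lookup (withCopies A) ∘ (_↑ˡ m))
    + count (lookup (withCopies A) ∘ (m ↑ʳ_))          ≡⟨ cong₂ _+_ (count-all _ (withCopies-base A))
                                                                    (count-cong (withCopies-copy A)) ⟩
  m + count A                                          ∎
  where open ≡-Reasoning

coNeighbour : ∀ {m} → Graph m → (Fin m → Bool) → Bool → Fin m → Fin m → Set
coNeighbour G A b k r = complement G k r ≡ true × A r ≡ b

withCopies-isRestrainedDom :
  ∀ {m} (G : Graph m) (A : Fin m → Bool) →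
  (∀ i → ∃ λ j → G i j ≡ true × i ≢ j) →
  (∀ k → A k ≡ false → ∃ λ r → coNeighbour G A true k r) →
  (∀ k → A k ≡ false → ∃₂ λ b₁ b₂ →
                          b₁ ≢ b₂ × coNeighbour G A false k b₁ × coNeighbour G A false k b₂) →
  IsKTupleRestrainedDom (compPrism G) 2 (withCopies A)
withCopies-isRestrainedDom {m} G A hasNbr dominated restrained =
  (λ x → subst (2 ≤_) (sym (∣tabulate∩∣ _ S)) (dom x)) ,
  (λ x x∉S → subst (2 ≤_) (sym (∣tabulate∩∁∣ _ S)) (restr x x∉S))
  where
  H : Graph (m + m)
  H = compPrism G
  S : Subset (m + m)
  S = withCopies A
  inS : ∀ {x y} → closedAdj H x y ≡ true → lookup S y ≡ true → closedAdj H x y ∧ lookup S y ≡ true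
  inS = cong₂ _∧_
  outS : ∀ {x y} → H x y ≡ true → lookup S y ≡ false → H x y ∧ not (lookup S y) ≡ true
  outS Hxy Sy = cong₂ _∧_ Hxy (cong not Sy)
  dom : ∀ x → 2 ≤ count (λ y → closedAdj H x y ∧ lookup S y)
  dom x with side {m} x
  ... | base i with hasNbr i
  ...   | j , Gij , i≢j = count≥2 _
          (inS (closedAdj-refl H (i ↑ˡ m)) (withCopies-base A i))
          (inS (adjacent⇒closedAdj H (trans (compPrism-ˡˡ G i j) Gij)) (withCopies-base A j))
          (i≢j ∘ ↑ˡ-injective m i j)
  dom x | copy k with A k in Ak
  ...   | true  = count≥2 _
          (inS (closedAdj-refl H (m ↑ʳ k)) (trans (withCopies-copy A k) Ak))
          (inS (adjacent⇒closedAdj H (trans (compPrism-ʳˡ G k k) (==-refl k))) (withCopies-base A k))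
          (↑ˡ≢↑ʳ k k ∘ sym)
  ...   | false with dominated k Ak
  ...     | r , kr , Ar = count≥2 _
          (inS (adjacent⇒closedAdj H (trans (compPrism-ʳˡ G k k) (==-refl k))) (withCopies-base A k))
          (inS (adjacent⇒closedAdj H (trans (compPrism-ʳʳ G k r) kr)) (trans (withCopies-copy A r) Ar))
          (↑ˡ≢↑ʳ k r)
  restr : ∀ x → x ∉ S → 2 ≤ count (λ y → H x y ∧ not (lookup S y))
  restr x x∉S with side {m} x
  ... | base i = contradiction (lookup⇒[]= _ S (withCopies-base A i)) x∉S
  ... | copy k with A k in Ak
  ...   | true  = contradiction (lookup⇒[]= _ S (trans (withCopies-copy A k) Ak)) x∉S
  ...   | false with restrained k Ak
  ...     | b₁ , b₂ , b₁≢b₂ , (kb₁ , Ab₁) , (kb₂ , Ab₂) = count≥2 _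
          (outS (trans (compPrism-ʳʳ G k b₁) kb₁) (trans (withCopies-copy A b₁) Ab₁))
          (outS (trans (compPrism-ʳʳ G k b₂) kb₂) (trans (withCopies-copy A b₂) Ab₂))
          (b₁≢b₂ ∘ ↑ʳ-injective m b₁ b₂)

-- Cycles

≡ᵇ-refl : ∀ a → (a ≡ᵇ a) ≡ true
≡ᵇ-refl zero    = refl
≡ᵇ-refl (suc a) = ≡ᵇ-refl a

≡ᵇ-true⇒≡ : ∀ a b → (a ≡ᵇ b) ≡ true → a ≡ b
≡ᵇ-true⇒≡ a b e = ≡ᵇ⇒≡ a b (subst T (sym e) _)

≢⇒≡ᵇ-false : ∀ {a b} → a ≢ b → (a ≡ᵇ b) ≡ false
≢⇒≡ᵇ-false {a} {b} a≢b = ¬-not (a≢b ∘ ≡ᵇ-true⇒≡ a b)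

suc%-cases : ∀ {n} a → a < suc n → suc a % suc n ≡ suc a ⊎ (suc a ≡ suc n × suc a % suc n ≡ 0)
suc%-cases {n} a a<n with suc a <? suc n
... | yes sa<n = inj₁ (m<n⇒m%n≡m sa<n)
... | no  sa≮n = inj₂ (sa≡n , trans (cong (_% suc n) sa≡n) (n%n≡0 (suc n)))
  where
  sa≡n : suc a ≡ suc n
  sa≡n = ≤-antisym a<n (≮⇒≥ sa≮n)

suc%-injective : ∀ {n a b} → a < suc n → b < suc n → suc a % suc n ≡ suc b % suc n → a ≡ b
suc%-injective {a = a} {b} a<n b<n e with suc%-cases a a<n | suc%-cases b b<n
... | inj₁ p       | inj₁ q       = ℕ-suc-injective (trans (sym p) (trans e q))
... | inj₁ p       | inj₂ (_ , q) with () ← trans (sym p) (trans e q)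
... | inj₂ (_ , p) | inj₁ q       with () ← trans (sym q) (trans (sym e) p)
... | inj₂ (p , _) | inj₂ (q , _) = ℕ-suc-injective (trans p (sym q))

Cycle-sym : ∀ {n} (i j : Fin n) → Cycle n i j ≡ Cycle n j i
Cycle-sym {suc n} i j = ∨-comm (suc (toℕ i) % suc n ≡ᵇ toℕ j) _

Cycle-degree≤2 : ∀ {n} (i : Fin n) → ∣ N (Cycle n) i ∣ ≤ 2
Cycle-degree≤2 {suc n} i =
  ≤-trans (count-∨ succ pred) (+-mono-≤ (count≤1 succ succ-unique) (count≤1 pred pred-unique))
  where
  succ pred : Fin (suc n) → Bool
  succ j = suc (toℕ i) % suc n ≡ᵇ toℕ j
  pred j = suc (toℕ j) % suc n ≡ᵇ toℕ i
  succ-unique : ∀ y z → succ y ≡ true → succ z ≡ true → y ≡ z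
  succ-unique y z sy sz = toℕ-injective (trans (sym (≡ᵇ-true⇒≡ (suc (toℕ i) % suc n) (toℕ y) sy))
                                                 (≡ᵇ-true⇒≡ (suc (toℕ i) % suc n) (toℕ z) sz))
  pred-unique : ∀ y z → pred y ≡ true → pred z ≡ true → y ≡ z
  pred-unique y z py pz =
    toℕ-injective (suc%-injective (toℕ<n y) (toℕ<n z)
                    (trans (≡ᵇ-true⇒≡ _ (toℕ i) py) (sym (≡ᵇ-true⇒≡ _ (toℕ i) pz))))

Cycle-hasNeighbour : ∀ {n} (i : Fin (2 + n)) → ∃ λ j → Cycle (2 + n) i j ≡ true × i ≢ j
Cycle-hasNeighbour {n} i = j , cong (_∨ (suc (toℕ j) % (2 + n) ≡ᵇ toℕ i)) succ≡j , i≢j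
  where
  j : Fin (2 + n)
  j = fromℕ< (m%n<n (suc (toℕ i)) (2 + n))
  toℕ-j : toℕ j ≡ suc (toℕ i) % (2 + n)
  toℕ-j = toℕ-fromℕ< _
  succ≡j : (suc (toℕ i) % (2 + n) ≡ᵇ toℕ j) ≡ true
  succ≡j = trans (cong (suc (toℕ i) % (2 + n) ≡ᵇ_) toℕ-j) (≡ᵇ-refl (suc (toℕ i) % (2 + n)))
  i≢j : i ≢ j
  i≢j i≡j with suc%-cases (toℕ i) (toℕ<n i)
  ... | inj₁ p       = 1+n≢n (sym (trans (cong toℕ i≡j) (trans toℕ-j p)))
  ... | inj₂ (q , p) = contradiction (trans (cong suc (sym (trans (cong toℕ i≡j) (trans toℕ-j p)))) q) λ ()

Cycle-far : ∀ {n} {i j : Fin (suc n)} → 1 ≤ toℕ i → 2 + toℕ i ≤ toℕ j → Cycle (suc n) i j ≡ false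
Cycle-far {n} {i} {j} 1≤i i+2≤j = cong₂ _∨_ (≢⇒≡ᵇ-false succ≢j) (≢⇒≡ᵇ-false pred≢i)
  where
  i<j : toℕ i < toℕ j
  i<j = m+n≤o⇒n≤o 1 i+2≤j
  succ≢j : suc (toℕ i) % suc n ≢ toℕ j
  succ≢j e = <-irrefl (trans (sym (m<n⇒m%n≡m (<-trans i+2≤j (toℕ<n j)))) e) i+2≤j
  pred≢i : suc (toℕ j) % suc n ≢ toℕ i
  pred≢i e with suc%-cases (toℕ j) (toℕ<n j)
  ... | inj₁ p       = <-irrefl (sym (trans (sym p) e)) (m<n⇒m<1+n i<j)
  ... | inj₂ (_ , p) = contradiction (subst (1 ≤_) (trans (sym e) p) 1≤i) λ ()

complement-Cycle-far : ∀ {n} {i j : Fin (suc n)} → 1 ≤ toℕ i → 2 + toℕ i ≤ toℕ j →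
                       complement (Cycle (suc n)) i j ≡ true × complement (Cycle (suc n)) j i ≡ true
complement-Cycle-far {n} {i} {j} 1≤i i+2≤j =
  cong₂ (λ a b → not a ∧ not b) far (≢⇒==-false i≢j) ,
  cong₂ (λ a b → not a ∧ not b) (trans (Cycle-sym j i) far) (≢⇒==-false (i≢j ∘ sym))
  where
  far : Cycle (suc n) i j ≡ false
  far = Cycle-far 1≤i i+2≤j
  i≢j : i ≢ j
  i≢j i≡j = <-irrefl (cong toℕ i≡j) (m+n≤o⇒n≤o 1 i+2≤j)

anchor : ∀ {n} → Fin n → Bool
anchor k = (toℕ k ≡ᵇ 0) ∨ (toℕ k ≡ᵇ 3)

count-anchor : ∀ m → count (anchor {6 + m}) ≡ 2
count-anchor m = cong (2 +_) (count-none (anchor {6 + m} ∘ (6 ↑ʳ_)) λ _ → refl)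

module _ {m : ℕ} where

  -- The side conditions of complement-Cycle-far are closed by evaluation.
  complement-Cycle-far′ : (i j : Fin (6 + m)) {_ : T (1 ≤ᵇ toℕ i)} {_ : T (2 + toℕ i ≤ᵇ toℕ j)} →
                          complement (Cycle (6 + m)) i j ≡ true × complement (Cycle (6 + m)) j i ≡ true
  complement-Cycle-far′ i j {1≤i} {i+2≤j} =
    complement-Cycle-far (≤ᵇ⇒≤ 1 (toℕ i) 1≤i) (≤ᵇ⇒≤ (2 + toℕ i) (toℕ j) i+2≤j)

  anchor-dominates : (k : Fin (6 + m)) → anchor k ≡ false →
                     ∃ λ r → coNeighbour (Cycle (6 + m)) anchor true k r
  anchor-dominates 1F _ = 3F , proj₁ (complement-Cycle-far′ 1F 3F) , refl
  anchor-dominates 2F _ = 0F , refl , refl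
  anchor-dominates 4F _ = 0F , refl , refl
  anchor-dominates k@(suc (suc (suc (suc (suc _))))) _ = 3F , proj₂ (complement-Cycle-far′ 3F k) , refl

  anchor-restrains : (k : Fin (6 + m)) → anchor k ≡ false →
                     ∃₂ λ b₁ b₂ → b₁ ≢ b₂ × coNeighbour (Cycle (6 + m)) anchor false k b₁
                                          × coNeighbour (Cycle (6 + m)) anchor false k b₂
  anchor-restrains 1F _ = 4F , 5F , (λ ()) , (proj₁ (complement-Cycle-far′ 1F 4F) , refl)
                                           , (proj₁ (complement-Cycle-far′ 1F 5F) , refl)
  anchor-restrains 2F _ = 4F , 5F , (λ ()) , (proj₁ (complement-Cycle-far′ 2F 4F) , refl)
                                           , (proj₁ (complement-Cycle-far′ 2F 5F) , refl)
  anchor-restrains 4F _ = 1F , 2F , (λ ()) , (proj₂ (complement-Cycle-far′ 1F 4F) , refl)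
                                           , (proj₂ (complement-Cycle-far′ 2F 4F) , refl)
  anchor-restrains k@(suc (suc (suc (suc (suc _))))) _ =
                          1F , 2F , (λ ()) , (proj₂ (complement-Cycle-far′ 1F k) , refl)
                                           , (proj₂ (complement-Cycle-far′ 2F k) , refl)

corollary5p3 : (n : ℕ) → 4 ≤ n →
    KTupleRestrainedDomNumberIs (compPrism (Cycle n)) 2
      (if (n ≡ᵇ 4) ∨ (n ≡ᵇ 5) then 2 * n else n + 2)
corollary5p3 1 (s≤s ())
corollary5p3 2 (s≤s (s≤s ()))
corollary5p3 3 (s≤s (s≤s (s≤s ())))
corollary5p3 4 _ = prism-restrainedDomNumber-lowDegree (Cycle 4)
                     (from-yes (all? {n = 8} λ x → ∣ N (compPrism (Cycle 4)) x ∣ ≤? 3))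
corollary5p3 5 _ = prism-restrainedDomNumber-lowDegree (Cycle 5)
                     (from-yes (all? {n = 10} λ x → ∣ N (compPrism (Cycle 5)) x ∣ ≤? 3))
corollary5p3 (suc (suc (suc (suc (suc (suc m)))))) _ =
  (withCopies (anchor {n}) , isDom , trans (∣withCopies∣ (anchor {n})) (cong (n +_) (count-anchor m))) ,
  prism-lowerBound (Cycle n) Cycle-degree≤2 hasInNeighbour
  where
  n : ℕ
  n = 6 + m
  isDom : IsKTupleRestrainedDom (compPrism (Cycle n)) 2 (withCopies (anchor {n}))
  isDom = withCopies-isRestrainedDom (Cycle n) anchor Cycle-hasNeighbour anchor-dominates anchor-restrains
  hasInNeighbour : ∀ j → ∃ λ i → Cycle n i j ≡ true × i ≢ j
  hasInNeighbour j with Cycle-hasNeighbour j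
  ... | i , ji , j≢i = i , trans (Cycle-sym i j) ji , j≢i ∘ sym
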